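{- For every group $\alpha$, each of the following formulas is valid in every frame that is up and down reflexive and up and down symmetric: - $[\alpha]p\rightarrow p$; - $p\rightarrow\langle\alpha\rangle p$; - $p\rightarrow[\alpha]\langle\alpha\rangle p$; - $\langle\alpha\rangle[\alpha]p\rightarrow p$. A frame is up and down reflexive if, for every group $\beta$ and every $s$, both $s\,(\leq\circ R(\beta)\circ\leq)\,s$ and $s\,(\geq\circ R(\beta)\circ\geq)\,s$ hold. It is up and down symmetric if, for every group $\beta$ and all $s,t$, $sR(\beta)t$ implies both $t\,(\leq\circ R(\beta)\circ\leq)\,s$ and $t\,(\geq\circ R(\beta)\circ\geq)\,s$.
   Context: **Language.** Let $\mathbf{At}$ be a countably infinite set of atoms and let $\mathbf{Ag}$ be a finite set of agents. A group is a nonempty subset of $\mathbf{Ag}$. Formulas are generated by $$A ::= p \mid (A\rightarrow A) \mid \top \mid \bot \mid (A\vee A) \mid (A\wedge A) \mid [\alpha]A \mid \langle\alpha\rangle A.$$ **Frames.** A frame is a triple $(W,\leq,R)$ where $W$ is a nonempty set, $\leq$ is a preorder on $W$, and $R$ assigns to each group $\alpha$ a binary relation $R(\alpha)$ on $W$. For binary relations $S,T$, write $s\,(S\circ T)\,t$ iff there is $u$ with $sSu$ and $uTt$ (composition is associative). Write $\geq$ for the converse of $\leq$. **Models and satisfaction.** A valuation is a map $V:\mathbf{At}\to\wp(W)$ with each $V(p)$ upward closed under $\leq$. Satisfaction in a model $(W,\leq,R,V)$ is defined as follows: - $s\models p$ iff $s\in V(p)$; - $s\models A\rightarrow B$ iff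 for all $t\geq s$, either $t\not\models A$ or $t\models B$; - $s\models\top$, and $s\not\models\bot$; - $\vee$ and $\wedge$ are interpreted pointwise; - $s\models[\alpha]A$ iff for all $t$ with $s\,(\leq\circ R(\alpha))\,t$, $t\models A$; - $s\models\langle\alpha\rangle A$ iff there is $t$ with $s\,(\geq\circ R(\alpha))\,t$ and $t\models A$. A formula is valid in a frame if it is satisfied at every state of every model based on that frame. -}

module Defs where

open import Level using (0ℓ)
open import Data.Nat using (ℕ)
open import Data.Fin.Subset using (Subset; Nonempty)
open import Data.Product using (Σ; _×_; ∃-syntax; _,_)
open import Data.Sum using (_⊎_)
open import Data.Unit using (⊤)
open import Data.Empty using (⊥)
open import Relation.Binary using (Rel; IsPreorder)
open import Relation.Binary.PropositionalEquality using (_≡_)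

Atom : Set
Atom = ℕ

Group : ℕ → Set
Group n = Σ (Subset n) Nonempty

infixr 5 _⇒_
infixr 6 _∨_
infixr 7 _∧_

data Form (n : ℕ) : Set where
  atom : Atom → Form n
  _⇒_  : Form n → Form n → Form n
  ⊤'   : Form n
  ⊥'   : Form n
  _∨_  : Form n → Form n → Form n
  _∧_  : Form n → Form n → Form n
  box  : Group n → Form n → Form n
  dia  : Group n → Form n → Form n

_∘ᵣ_ : {W : Set} → Rel W 0ℓ → Rel W 0ℓ → Rel W 0ℓ
(S ∘ᵣ T) s t = ∃[ u ] (S s u × T u t)

infixr 9 _∘ᵣ_

conv : {W : Set} → Rel W 0ℓ → Rel W 0ℓ
conv S s t = S t s

record Frame (n : ℕ) : Set₁ where
  field
    W     : Set
    inhabited : W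
    _≤_   : Rel W 0ℓ
    isPreorder : IsPreorder _≡_ _≤_
    R     : Group n → Rel W 0ℓ

  _≥_ : Rel W 0ℓ
  _≥_ = conv _≤_

record Valuation {n : ℕ} (F : Frame n) : Set₁ where
  open Frame F
  field
    V       : Atom → W → Set
    upward  : ∀ p {s t} → s ≤ t → V p s → V p t

module _ {n : ℕ} (F : Frame n) (Val : Valuation F) where
  open Frame F
  open Valuation Val

  _⊨_ : W → Form n → Set
  s ⊨ atom p  = V p s
  s ⊨ (A ⇒ B) = ∀ t → s ≤ t → (t ⊨ A → t ⊨ B)
  s ⊨ ⊤'      = ⊤
  s ⊨ ⊥'      = ⊥
  s ⊨ (A ∨ B) = s ⊨ A ⊎ s ⊨ B
  s ⊨ (A ∧ B) = s ⊨ A × s ⊨ B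
  s ⊨ box α A = ∀ t → (_≤_ ∘ᵣ R α) s t → t ⊨ A
  s ⊨ dia α A = ∃[ t ] ((_≥_ ∘ᵣ R α) s t × t ⊨ A)

ValidIn : {n : ℕ} → Frame n → Form n → Set₁
ValidIn F A = (Val : Valuation F) → ∀ s → _⊨_ F Val s A

UpDownReflexive : {n : ℕ} → Frame n → Set
UpDownReflexive F = ∀ β s →
    (_≤_ ∘ᵣ R β ∘ᵣ _≤_) s s × (_≥_ ∘ᵣ R β ∘ᵣ _≥_) s s
  where open Frame F

UpDownSymmetric : {n : ℕ} → Frame n → Set
UpDownSymmetric F = ∀ β s t → R β s t →
    (_≤_ ∘ᵣ R β ∘ᵣ _≤_) t s × (_≥_ ∘ᵣ R β ∘ᵣ _≥_) t s
  where open Frame F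

-- All four axioms hold for an arbitrary formula A, not just an atom, because truth is
-- persistent along ≤.  Each reflexivity or symmetry witness is a path s ≤ u R v ≤ s'
-- (or its ≥ variant): the R-step is handled by the modal clause, and the ≤-steps at
-- either end are absorbed by persistence or by transitivity of ≤.
module Submission where

open import Defs
open import Data.Nat using (ℕ)
open import Data.Product using (_×_; _,_; proj₁; proj₂)
open import Data.Sum using (inj₁; inj₂)
open import Relation.Binary using (IsPreorder)

module _ {n : ℕ} (F : Frame n) where
  open Frame F

  private
    ≤-trans : ∀ {s t u} → s ≤ t → t ≤ u → s ≤ u
    ≤-trans = IsPreorder.trans isPreorder

  persistent : (Val : Valuation F) → ∀ A {s t} → s ≤ t → _⊨_ F Val s A → _⊨_ F Val t A
  persistent Val (atom p)  s≤t h = Valuation.upward Val p s≤t h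
  persistent Val (A ⇒ B)   s≤t h u t≤u = h u (≤-trans s≤t t≤u)
  persistent Val ⊤'        s≤t h = h
  persistent Val ⊥'        s≤t ()
  persistent Val (A ∨ B)   s≤t (inj₁ h) = inj₁ (persistent Val A s≤t h)
  persistent Val (A ∨ B)   s≤t (inj₂ h) = inj₂ (persistent Val B s≤t h)
  persistent Val (A ∧ B)   s≤t (hA , hB) = persistent Val A s≤t hA , persistent Val B s≤t hB
  persistent Val (box α A) s≤t h u (v , t≤v , vRu) = h u (v , ≤-trans s≤t t≤v , vRu)
  persistent Val (dia α A) s≤t (u , (v , v≤s , vRu) , hu) = u , (v , ≤-trans v≤s s≤t , vRu) , hu

  module _ (α : Group n) (A : Form n) where

    box-T-valid : (∀ s → (_≤_ ∘ᵣ R α ∘ᵣ _≤_) s s) → ValidIn F (box α A ⇒ A)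
    box-T-valid up-refl Val _ s _ h with up-refl s
    ... | u , s≤u , v , uRv , v≤s = persistent Val A v≤s (h v (u , s≤u , uRv))

    dia-T-valid : (∀ s → (_≥_ ∘ᵣ R α ∘ᵣ _≥_) s s) → ValidIn F (A ⇒ dia α A)
    dia-T-valid down-refl Val _ s _ h with down-refl s
    ... | u , u≤s , v , uRv , s≤v = v , (u , u≤s , uRv) , persistent Val A s≤v h

    box-dia-B-valid : (∀ s t → R α s t → (_≥_ ∘ᵣ R α ∘ᵣ _≥_) t s) →
                      ValidIn F (A ⇒ box α (dia α A))
    box-dia-B-valid down-sym Val _ s _ h t (u , s≤u , uRt) with down-sym u t uRt
    ... | v , v≤t , w , vRw , u≤w = w , (v , v≤t , vRw) , persistent Val A (≤-trans s≤u u≤w) h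

    dia-box-B-valid : (∀ s t → R α s t → (_≤_ ∘ᵣ R α ∘ᵣ _≤_) t s) →
                      ValidIn F (dia α (box α A) ⇒ A)
    dia-box-B-valid up-sym Val _ s _ (t , (u , u≤s , uRt) , ht) with up-sym u t uRt
    ... | v , t≤v , w , vRw , w≤u = persistent Val A (≤-trans w≤u u≤s) (ht w (v , t≤v , vRw))

proposition6 : (n : ℕ) (α : Group n) (F : Frame n) → UpDownReflexive F → UpDownSymmetric F → (p : Atom) →
    ValidIn F (box α (atom p) ⇒ atom p)
    × ValidIn F (atom p ⇒ dia α (atom p))
    × ValidIn F (atom p ⇒ box α (dia α (atom p)))
    × ValidIn F (dia α (box α (atom p)) ⇒ atom p)
proposition6 n α F refl sym p =
    box-T-valid     F α (atom p) (λ s → proj₁ (refl α s))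
  , dia-T-valid     F α (atom p) (λ s → proj₂ (refl α s))
  , box-dia-B-valid F α (atom p) (λ s t sRt → proj₂ (sym α s t sRt))
  , dia-box-B-valid F α (atom p) (λ s t sRt → proj₁ (sym α s t sRt))
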